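{- Let $n\ge 2$ and let $\tau:\mathsf{var}(\mathsf{NIP}_n)\to\{\bot,\top\}$ be an assignment (to all variables $x_{i,j}$, $1\le i<j\le n$, and $t_\ell$, $1\le\ell\le n$). Then $\tau\models\mathsf{NIP}_n$ if and only if $\mathsf{IPT}_n|_\tau$ is satisfiable. Moreover, every satisfying assignment $\theta$ of $\mathsf{IPT}_n|_\tau$ assigns $\theta(z_{a,b})=\top$ if and only if there is some interval $[i,j]$ with $\tau(x_{i,j})=\top$ and $[a,b]\subseteq[i,j]$.
   Context: Variables: $x_{i,j}$ for $1\le i<j\le n$ (interval $[i,j]$ selected), $t_\ell$ for $1\le\ell\le n$, and $z_{i,j}$ for $1\le i<j\le n$. For a formula $F$ and assignment $\tau$ to some of its variables, $F|_\tau$ is obtained by deleting clauses satisfied by $\tau$ and deleting from remaining clauses all literals falsified by $\tau$. $\mathsf{NIP}_n$ consists of the clauses $\overline{t_\ell}\lor\bigvee_{1\le i\le \ell\le j\le n,\ i<j} x_{i,j}$ for every $1\le\ell\le n$, together with $\overline{x_{i,j}}\lor t_\ell$ for every $1\le i<j\le n$ and every $i\le\ell\le j$. $\mathsf{IPT}_n$ consists of the clauses $\overline{t_\ell}\lor\bigvee_{1\le i\le \ell\le j\le n,\ i<j} x_{i,j}$ for every $1\le\ell\le n$, together with: (1) $\overline{x_{i,j}}\lor z_{i,j}$ for every $1\le i<j\le n$; (2) $\overline{z_{i,i+1}}\lor t_i$ and $\overline{z_{i,i+1}}\lor t_{i+1}$ for every $1\le i<n$; (3) $\overline{z_{i,j}}\lor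 z_{i+1,j}$ and $\overline{z_{i,j}}\lor z_{i,j-1}$ for every $1\le i<j-1<n$; (4) $\overline{z_{i,j}}\lor x_{i,j}\lor z_{i-1,j}\lor z_{i,j+1}$ for every $1\le i<j\le n$, where the literal $z_{i-1,j}$ is omitted when $i=1$ and the literal $z_{i,j+1}$ is omitted when $j=n$. -}

module Defs where

open import Data.Nat using (ℕ; zero; suc; _+_; _∸_; _≤ᵇ_; _≤_; _<_)
open import Data.Bool using (Bool; true; false; not; T)
open import Data.Maybe using (Maybe; just; nothing)
open import Data.List using (List; []; _∷_; map; concatMap; upTo; _++_; filterᵇ)
open import Data.Bool.ListAction using (any)
open import Data.List.Relation.Unary.All using (All)
open import Data.List.Relation.Unary.Any using (Any)
open import Data.Product using (Σ; _×_; _,_)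
open import Relation.Binary.PropositionalEquality using (_≡_)

-- Propositional variables of NIP_n and IPT_n:
--   x i j  (interval [i,j] selected),  t ℓ,  z i j.

data Var : Set where
  x : ℕ → ℕ → Var
  t : ℕ → Var
  z : ℕ → ℕ → Var

data Lit : Set where
  pos : Var → Lit
  neg : Var → Lit

Clause : Set
Clause = List Lit

CNF : Set
CNF = List Clause

Assignment : Set
Assignment = Var → Bool

litVal : Assignment → Lit → Bool
litVal θ (pos v) = θ v
litVal θ (neg v) = not (θ v)

_⊨ᶜ_ : Assignment → Clause → Set
θ ⊨ᶜ C = Any (λ l → litVal θ l ≡ true) C

_⊨_ : Assignment → CNF → Set
θ ⊨ F = All (λ C → θ ⊨ᶜ C) F

Satisfiable : CNF → Set
Satisfiable F = Σ Assignment (λ θ → θ ⊨ F)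

PartialAssignment : Set
PartialAssignment = Var → Maybe Bool

plitVal : PartialAssignment → Lit → Maybe Bool
plitVal ρ (pos v) = ρ v
plitVal ρ (neg v) with ρ v
... | just b  = just (not b)
... | nothing = nothing

isTrue : Maybe Bool → Bool
isTrue (just true) = true
isTrue _ = false

isFalse : Maybe Bool → Bool
isFalse (just false) = true
isFalse _ = false

restrictClause : PartialAssignment → Clause → Clause
restrictClause ρ C = filterᵇ (λ l → not (isFalse (plitVal ρ l))) C

_∣_ : CNF → PartialAssignment → CNF
[] ∣ ρ = []
(C ∷ F) ∣ ρ with any (λ l → isTrue (plitVal ρ l)) C
... | true  = F ∣ ρ
... | false = restrictClause ρ C ∷ (F ∣ ρ)

-- [a .. b] (empty if a > b).
range : ℕ → ℕ → List ℕ
range a b = map (λ k → a + k) (upTo (suc b ∸ a))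

pairs : ℕ → List (ℕ × ℕ)
pairs n = concatMap (λ i → map (λ j → (i , j)) (range (suc i) n)) (range 1 n)

tClause : ℕ → ℕ → Clause
tClause n ℓ = neg (t ℓ) ∷
  concatMap (λ i → map (λ j → pos (x i j))
                       (filterᵇ (λ j → ℓ ≤ᵇ j) (range (suc i) n)))
            (range 1 ℓ)

tClauses : ℕ → CNF
tClauses n = map (tClause n) (range 1 n)

NIP : ℕ → CNF
NIP n = tClauses n ++
  concatMap (λ p → let i = Data.Product.proj₁ p ; j = Data.Product.proj₂ p in
                   map (λ ℓ → neg (x i j) ∷ pos (t ℓ) ∷ []) (range i j))
            (pairs n)

IPT : ℕ → CNF
IPT n = tClauses n
  -- (1)  ¬x_{i,j} ∨ z_{i,j}
  ++ map (λ p → neg (x (proj₁ p) (proj₂ p)) ∷ pos (z (proj₁ p) (proj₂ p)) ∷ []) (pairs n)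
  -- (2)  ¬z_{i,i+1} ∨ t_i   and   ¬z_{i,i+1} ∨ t_{i+1},   1 ≤ i < n
  ++ concatMap (λ i → (neg (z i (suc i)) ∷ pos (t i) ∷ [])
                    ∷ (neg (z i (suc i)) ∷ pos (t (suc i)) ∷ []) ∷ [])
               (range 1 (n ∸ 1))
  -- (3)  ¬z_{i,j} ∨ z_{i+1,j}  and  ¬z_{i,j} ∨ z_{i,j-1},   1 ≤ i < j-1 < n
  ++ concatMap (λ p → let i = proj₁ p ; j = proj₂ p in
                      (neg (z i j) ∷ pos (z (suc i) j) ∷ [])
                    ∷ (neg (z i j) ∷ pos (z i (j ∸ 1)) ∷ []) ∷ [])
               (filterᵇ (λ p → suc (suc (proj₁ p)) ≤ᵇ proj₂ p) (pairs n))
  -- (4)  ¬z_{i,j} ∨ x_{i,j} ∨ z_{i-1,j} ∨ z_{i,j+1}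
  --      (z_{i-1,j} omitted if i = 1, z_{i,j+1} omitted if j = n)
  ++ map (λ p → let i = proj₁ p ; j = proj₂ p in
                neg (z i j) ∷ pos (x i j) ∷ (left i j ++ right i j))
         (pairs n)
  where
  open Data.Product using (proj₁; proj₂)
  left : ℕ → ℕ → Clause
  left (suc (suc i')) j = pos (z (suc i') j) ∷ []
  left _ _ = []
  right : ℕ → ℕ → Clause
  right i j with n ≤ᵇ j
  ... | true  = []
  ... | false = pos (z i (suc j)) ∷ []

-- An assignment τ to var(NIP_n): values for every x_{i,j} and t_ℓ.
-- (Values outside the index ranges are irrelevant.)

record NIPAssignment : Set where
  constructor mkτ
  field
    xval : ℕ → ℕ → Bool
    tval : ℕ → Bool

-- τ as a total assignment (z's set arbitrarily to false; z does not occur in NIP_n).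
total : NIPAssignment → Assignment
total τ (x i j) = NIPAssignment.xval τ i j
total τ (t ℓ)   = NIPAssignment.tval τ ℓ
total τ (z _ _) = false

partial : NIPAssignment → PartialAssignment
partial τ (x i j) = just (NIPAssignment.xval τ i j)
partial τ (t ℓ)   = just (NIPAssignment.tval τ ℓ)
partial τ (z _ _) = nothing

{-# OPTIONS --safe #-}
-- Write σ for τ extended by θ on the z-variables; θ satisfies IPT_n|τ iff σ
-- satisfies IPT_n.  In a model of IPT_n, clauses (1) and (3) push z from a
-- selected interval down to all its subintervals, and clause (4) lets a true
-- z_{a,b} grow, one endpoint at a time, until it reaches a selected interval;
-- so z_{a,b} holds exactly when [a,b] is covered by a selected interval.
-- Shrinking to unit intervals, clauses (2) give t_ℓ for every ℓ in a selected
-- interval, which are the remaining clauses of NIP_n.  Conversely, a model of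
-- NIP_n with z set to coverage satisfies every clause of IPT_n.
module Submission where

open import Defs
open import Data.Nat
  using (ℕ; zero; suc; pred; _+_; _∸_; _≤ᵇ_; _≤_; _<_; _≤′_; ≤′-refl; ≤′-step; z≤n; s≤s; s≤s⁻¹; _≤?_)
open import Data.Nat.Properties
  using (≤-refl; ≤-trans; <-trans; ≤-<-trans; <-≤-trans; <⇒≤; <-irrefl; n≤1+n; n<1+n; m<n⇒m<1+n;
         <⇒≤pred; pred[n]≤n; m≤m+n; +-suc; m∸n+n≡m; m+[n∸m]≡n; ∸-monoˡ-<; m≤n⇒m<n∨m≡n; ≤⇒≤′; ≤′⇒≤;
         ≤ᵇ-reflects-≤; ≤ᵇ⇒≤; ≤⇒≤ᵇ; ≰⇒>; <⇒≱)
open import Data.Bool using (Bool; true; false; not)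
open import Data.Bool.Properties using (T-≡; not-¬) renaming (_≟_ to _≟ᵇ_)
open import Data.Maybe using (just; nothing; fromMaybe)
open import Data.List using ([]; _∷_; map; concatMap; _++_; filterᵇ)
open import Data.Bool.ListAction using (any)
open import Data.List.Relation.Unary.All as All using (All; []; _∷_)
open import Data.List.Relation.Unary.Any as Any using (Any; here; there)
open import Data.List.Relation.Unary.Any.Properties using (++⁺ˡ; ++⁺ʳ; ++⁻)
open import Data.List.Membership.Propositional using (_∈_; find; lose)
open import Data.List.Membership.Propositional.Properties
  using (∈-map⁺; ∈-map⁻; ∈-++⁺ˡ; ∈-++⁺ʳ; ∈-++⁻; ∈-concatMap⁺; ∈-concatMap⁻; ∈-filter⁺; ∈-filter⁻;
         ∈-upTo⁺; ∈-upTo⁻)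
open import Data.Product using (_×_; ∃; _,_; proj₁; proj₂)
open import Data.Sum using (_⊎_; inj₁; inj₂)
open import Function.Base using (_∘_; _∋_)
open import Function.Bundles using (_⇔_; mk⇔; Equivalence)
open import Relation.Nullary using (Dec; contradiction)
open import Relation.Nullary.Reflects using (ofʸ; ofⁿ)
open import Relation.Nullary.Decidable using (T?; map′; _×-dec_; ⌊_⌋; toWitness; fromWitness)
open import Relation.Binary.PropositionalEquality using (_≡_; refl; sym; trans; cong; subst)

open Equivalence using (to; from)

variable
  n a b i j ℓ : ℕ
  u w : Var
  C : Clause
  σ σ₁ σ₂ : Assignment

extend : PartialAssignment → Assignment → Assignment
extend ρ θ v = fromMaybe (θ v) (ρ v)

module _ (ρ : PartialAssignment) (θ : Assignment) where

  litVal-extend : ∀ l {r} → plitVal ρ l ≡ r → litVal (extend ρ θ) l ≡ fromMaybe (litVal θ l) r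
  litVal-extend (pos v) refl = refl
  litVal-extend (neg v) refl with ρ v
  ... | just _  = refl
  ... | nothing = refl

  ⊨ᶜ-satisfied : ∀ C → any (λ l → isTrue (plitVal ρ l)) C ≡ true → extend ρ θ ⊨ᶜ C
  ⊨ᶜ-satisfied (l ∷ C) sat with plitVal ρ l in ρl
  ... | just true  = here (litVal-extend l ρl)
  ... | just false = there (⊨ᶜ-satisfied C sat)
  ... | nothing    = there (⊨ᶜ-satisfied C sat)

  ⊨ᶜ-restrict⁺ : ∀ C → any (λ l → isTrue (plitVal ρ l)) C ≡ false →
                 extend ρ θ ⊨ᶜ C → θ ⊨ᶜ restrictClause ρ C
  ⊨ᶜ-restrict⁺ (l ∷ C) unsat s with plitVal ρ l in ρl
  ⊨ᶜ-restrict⁺ (l ∷ C) ()    s         | just true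
  ⊨ᶜ-restrict⁺ (l ∷ C) unsat (here h)  | just false =
    contradiction (trans (sym h) (litVal-extend l ρl)) λ ()
  ⊨ᶜ-restrict⁺ (l ∷ C) unsat (there s) | just false = ⊨ᶜ-restrict⁺ C unsat s
  ⊨ᶜ-restrict⁺ (l ∷ C) unsat (here h)  | nothing = here (trans (sym (litVal-extend l ρl)) h)
  ⊨ᶜ-restrict⁺ (l ∷ C) unsat (there s) | nothing = there (⊨ᶜ-restrict⁺ C unsat s)

  ⊨ᶜ-restrict⁻ : ∀ C → any (λ l → isTrue (plitVal ρ l)) C ≡ false →
                 θ ⊨ᶜ restrictClause ρ C → extend ρ θ ⊨ᶜ C
  ⊨ᶜ-restrict⁻ (l ∷ C) unsat s with plitVal ρ l in ρl
  ⊨ᶜ-restrict⁻ (l ∷ C) ()    s         | just true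
  ⊨ᶜ-restrict⁻ (l ∷ C) unsat s         | just false = there (⊨ᶜ-restrict⁻ C unsat s)
  ⊨ᶜ-restrict⁻ (l ∷ C) unsat (here h)  | nothing = here (trans (litVal-extend l ρl) h)
  ⊨ᶜ-restrict⁻ (l ∷ C) unsat (there s) | nothing = there (⊨ᶜ-restrict⁻ C unsat s)

  ⊨-restrict⁺ : ∀ F → extend ρ θ ⊨ F → θ ⊨ (F ∣ ρ)
  ⊨-restrict⁺ []      []       = []
  ⊨-restrict⁺ (C ∷ F) (s ∷ ss) with any (λ l → isTrue (plitVal ρ l)) C in sat
  ... | true  = ⊨-restrict⁺ F ss
  ... | false = ⊨ᶜ-restrict⁺ C sat s ∷ ⊨-restrict⁺ F ss

  ⊨-restrict⁻ : ∀ F → θ ⊨ (F ∣ ρ) → extend ρ θ ⊨ F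
  ⊨-restrict⁻ []      _  = []
  ⊨-restrict⁻ (C ∷ F) ss with any (λ l → isTrue (plitVal ρ l)) C in sat
  ⊨-restrict⁻ (C ∷ F) ss       | true  = ⊨ᶜ-satisfied C sat ∷ ⊨-restrict⁻ F ss
  ⊨-restrict⁻ (C ∷ F) (s ∷ ss) | false = ⊨ᶜ-restrict⁻ C sat s ∷ ⊨-restrict⁻ F ss

Interval : ℕ → ℕ → ℕ → Set
Interval n i j = 1 ≤ i × i < j × j ≤ n

∈-range⁺ : a ≤ ℓ → ℓ ≤ b → ℓ ∈ range a b
∈-range⁺ {a} {ℓ} {b} a≤ℓ ℓ≤b =
  subst (_∈ range a b) (m+[n∸m]≡n a≤ℓ) (∈-map⁺ (a +_) (∈-upTo⁺ (∸-monoˡ-< (s≤s ℓ≤b) a≤ℓ)))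

∈-range⁻ : ℓ ∈ range a b → a ≤ ℓ × ℓ ≤ b
∈-range⁻ {a = a} {b} ℓ∈ with ∈-map⁻ (a +_) ℓ∈
... | d , d∈ , refl = m≤m+n a d , s≤s⁻¹ (<∸⇒+< a (suc b) (∈-upTo⁻ d∈))
  where
  <∸⇒+< : ∀ a c → d < c ∸ a → a + d < c
  <∸⇒+< zero    c       d<c = d<c
  <∸⇒+< (suc a) (suc c) d<c = s≤s (<∸⇒+< a c d<c)

∈-pairs⁺ : Interval n i j → (i , j) ∈ pairs n
∈-pairs⁺ {n} {i} (1≤i , i<j , j≤n) =
  ∈-concatMap⁺ (λ i → map (i ,_) (range (suc i) n)) {range 1 n}
    (lose (∈-range⁺ 1≤i (≤-trans (<⇒≤ i<j) j≤n)) (∈-map⁺ (i ,_) (∈-range⁺ i<j j≤n)))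

∈-pairs⁻ : (i , j) ∈ pairs n → Interval n i j
∈-pairs⁻ {n = n} ij∈ with find (∈-concatMap⁻ (λ i → map (i ,_) (range (suc i) n)) {range 1 n} ij∈)
... | i , i∈ , ij∈′ with ∈-map⁻ (i ,_) ij∈′
...   | j , j∈ , refl = proj₁ (∈-range⁻ i∈) , ∈-range⁻ j∈

_⇒ᶜ_ : Var → Var → Clause
u ⇒ᶜ w = neg u ∷ pos w ∷ []

-- Clause (4), spelled as in the definition of IPT so that the two agree
-- once i and n ≤ᵇ j are split on.
leftExtension : ℕ → ℕ → Clause
leftExtension (suc (suc i)) j = pos (z (suc i) j) ∷ []
leftExtension _             _ = []

rightExtension : Bool → ℕ → ℕ → Clause
rightExtension true  _ _ = []
rightExtension false i j = pos (z i (suc j)) ∷ []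

extensionClause : ℕ → ℕ → ℕ → Clause
extensionClause n i j = neg (z i j) ∷ pos (x i j) ∷ leftExtension i j ++ rightExtension (n ≤ᵇ j) i j

data NIPClause (n : ℕ) : Clause → Set where
  t-clause   : 1 ≤ ℓ → ℓ ≤ n → NIPClause n (tClause n ℓ)
  x⇒t-clause : Interval n i j → i ≤ ℓ → ℓ ≤ j → NIPClause n (x i j ⇒ᶜ t ℓ)

data IPTClause (n : ℕ) : Clause → Set where
  t-clause         : 1 ≤ ℓ → ℓ ≤ n → IPTClause n (tClause n ℓ)
  x⇒z-clause       : Interval n i j → IPTClause n (x i j ⇒ᶜ z i j)
  z⇒tˡ-clause      : 1 ≤ i → i < n → IPTClause n (z i (suc i) ⇒ᶜ t i)
  z⇒tʳ-clause      : 1 ≤ i → i < n → IPTClause n (z i (suc i) ⇒ᶜ t (suc i))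
  z⇒zˡ-clause      : Interval n i j → suc i < j → IPTClause n (z i j ⇒ᶜ z (suc i) j)
  z⇒zʳ-clause      : Interval n i j → suc i < j → IPTClause n (z i j ⇒ᶜ z i (j ∸ 1))
  extension-clause : Interval n i j → IPTClause n (extensionClause n i j)

-- Pieces of tClause, NIP and IPT, copied from their definitions so that
-- membership can be split along _++_ and concatMap.
xLits : ℕ → ℕ → ℕ → Clause
xLits n ℓ i = map (λ j → pos (x i j)) (filterᵇ (λ j → ℓ ≤ᵇ j) (range (suc i) n))

xtClauses : ℕ × ℕ → CNF
xtClauses p = map (λ ℓ → x (proj₁ p) (proj₂ p) ⇒ᶜ t ℓ) (range (proj₁ p) (proj₂ p))

xzClauses : ℕ → CNF
xzClauses n = map (λ p → x (proj₁ p) (proj₂ p) ⇒ᶜ z (proj₁ p) (proj₂ p)) (pairs n)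

ztPair : ℕ → CNF
ztPair i = (z i (suc i) ⇒ᶜ t i) ∷ (z i (suc i) ⇒ᶜ t (suc i)) ∷ []

ztClauses : ℕ → CNF
ztClauses n = concatMap ztPair (range 1 (n ∸ 1))

zzPair : ℕ × ℕ → CNF
zzPair p = (z (proj₁ p) (proj₂ p) ⇒ᶜ z (suc (proj₁ p)) (proj₂ p))
         ∷ (z (proj₁ p) (proj₂ p) ⇒ᶜ z (proj₁ p) (proj₂ p ∸ 1)) ∷ []

isLong : ℕ × ℕ → Bool
isLong p = suc (suc (proj₁ p)) ≤ᵇ proj₂ p

zzClauses : ℕ → CNF
zzClauses n = concatMap zzPair (filterᵇ isLong (pairs n))

∈-tClauses⁻ : C ∈ tClauses n → ∃ λ ℓ → 1 ≤ ℓ × ℓ ≤ n × C ≡ tClause n ℓ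
∈-tClauses⁻ {n = n} C∈ with ∈-map⁻ (tClause n) C∈
... | ℓ , ℓ∈ , refl = ℓ , proj₁ (∈-range⁻ ℓ∈) , proj₂ (∈-range⁻ ℓ∈) , refl

∈-NIP⁻ : C ∈ NIP n → NIPClause n C
∈-NIP⁻ {n = n} C∈ with ∈-++⁻ (tClauses n) C∈
... | inj₁ C∈t with ∈-tClauses⁻ C∈t
...   | ℓ , 1≤ℓ , ℓ≤n , refl = t-clause 1≤ℓ ℓ≤n
∈-NIP⁻ {n = n} C∈ | inj₂ C∈xt with find (∈-concatMap⁻ xtClauses {pairs n} C∈xt)
... | (i , j) , ij∈ , C∈′ with ∈-map⁻ _ C∈′
...   | ℓ , ℓ∈ , refl = x⇒t-clause (∈-pairs⁻ ij∈) (proj₁ (∈-range⁻ ℓ∈)) (proj₂ (∈-range⁻ ℓ∈))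

∈-NIP⁺ : NIPClause n C → C ∈ NIP n
∈-NIP⁺ {n} (t-clause 1≤ℓ ℓ≤n) = ∈-++⁺ˡ (∈-map⁺ (tClause n) (∈-range⁺ 1≤ℓ ℓ≤n))
∈-NIP⁺ {n} (x⇒t-clause iv i≤ℓ ℓ≤j) = ∈-++⁺ʳ (tClauses n)
  (∈-concatMap⁺ xtClauses {pairs n} (lose (∈-pairs⁺ iv) (∈-map⁺ _ (∈-range⁺ i≤ℓ ℓ≤j))))

<⇒≤∸1 : i < n → i ≤ n ∸ 1
<⇒≤∸1 (s≤s i≤n) = i≤n

≤∸1⇒< : 1 ≤ i → i ≤ n ∸ 1 → i < n
≤∸1⇒< {n = zero}  (s≤s _) ()
≤∸1⇒< {n = suc _} _       i≤n = s≤s i≤n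

∈-IPT⁻ : C ∈ IPT n → IPTClause n C
∈-IPT⁻ {n = n} C∈ with ∈-++⁻ (tClauses n) C∈
... | inj₁ C∈t with ∈-tClauses⁻ C∈t
...   | ℓ , 1≤ℓ , ℓ≤n , refl = t-clause 1≤ℓ ℓ≤n
∈-IPT⁻ {n = n} C∈ | inj₂ C∈₁ with ∈-++⁻ (xzClauses n) C∈₁
... | inj₁ C∈xz with ∈-map⁻ _ C∈xz
...   | (i , j) , ij∈ , refl = x⇒z-clause (∈-pairs⁻ ij∈)
∈-IPT⁻ {n = n} C∈ | inj₂ _ | inj₂ C∈₂ with ∈-++⁻ (ztClauses n) C∈₂
... | inj₁ C∈zt with find (∈-concatMap⁻ ztPair {range 1 (n ∸ 1)} C∈zt)
...   | i , i∈ , C∈′ with ∈-range⁻ i∈ | C∈′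
...     | 1≤i , i≤n-1 | here refl         = z⇒tˡ-clause 1≤i (≤∸1⇒< 1≤i i≤n-1)
...     | 1≤i , i≤n-1 | there (here refl) = z⇒tʳ-clause 1≤i (≤∸1⇒< 1≤i i≤n-1)
∈-IPT⁻ {n = n} C∈ | inj₂ _ | inj₂ _ | inj₂ C∈₃ with ∈-++⁻ (zzClauses n) C∈₃
... | inj₁ C∈zz with find (∈-concatMap⁻ zzPair {filterᵇ isLong (pairs n)} C∈zz)
...   | (i , j) , ij∈ , C∈′ with ∈-filter⁻ (T? ∘ isLong) {xs = pairs n} ij∈ | C∈′
...     | ij∈′ , long | here refl         = z⇒zˡ-clause (∈-pairs⁻ ij∈′) (≤ᵇ⇒≤ _ _ long)
...     | ij∈′ , long | there (here refl) = z⇒zʳ-clause (∈-pairs⁻ ij∈′) (≤ᵇ⇒≤ _ _ long)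
∈-IPT⁻ {n = n} C∈ | inj₂ _ | inj₂ _ | inj₂ _ | inj₂ C∈₄ with ∈-map⁻ _ C∈₄
... | (zero , j) , ij∈ , refl = contradiction (proj₁ (∈-pairs⁻ {n = n} ij∈)) λ ()
... | (suc zero , j) , ij∈ , refl with n ≤ᵇ j | extension-clause {n} {1} {j} (∈-pairs⁻ ij∈)
...   | true  | c = c
...   | false | c = c
∈-IPT⁻ {n = n} C∈ | inj₂ _ | inj₂ _ | inj₂ _ | inj₂ C∈₄ | (suc (suc i) , j) , ij∈ , refl
  with n ≤ᵇ j | extension-clause {n} {suc (suc i)} {j} (∈-pairs⁻ ij∈)
... | true  | c = c
... | false | c = c

∈-ztClauses⁺ : 1 ≤ i → i < n → C ∈ ztPair i → C ∈ ztClauses n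
∈-ztClauses⁺ 1≤i i<n C∈ = ∈-concatMap⁺ ztPair (lose (∈-range⁺ 1≤i (<⇒≤∸1 i<n)) C∈)

∈-zzClauses⁺ : Interval n i j → suc i < j → C ∈ zzPair (i , j) → C ∈ zzClauses n
∈-zzClauses⁺ iv long C∈ = ∈-concatMap⁺ zzPair (lose (∈-filter⁺ (T? ∘ isLong) (∈-pairs⁺ iv) (≤⇒≤ᵇ long)) C∈)

∈-IPT-suffix : ∀ {ys} → C ∈ ys → C ∈ tClauses n ++ xzClauses n ++ ztClauses n ++ zzClauses n ++ ys
∈-IPT-suffix {n = n} C∈ =
  ∈-++⁺ʳ (tClauses n) (∈-++⁺ʳ (xzClauses n) (∈-++⁺ʳ (ztClauses n) (∈-++⁺ʳ (zzClauses n) C∈)))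

∈-IPT⁺ : IPTClause n C → C ∈ IPT n
∈-IPT⁺ {n} (t-clause 1≤ℓ ℓ≤n) = ∈-++⁺ˡ (∈-map⁺ (tClause n) (∈-range⁺ 1≤ℓ ℓ≤n))
∈-IPT⁺ {n} (x⇒z-clause iv) = ∈-++⁺ʳ (tClauses n) (∈-++⁺ˡ (∈-map⁺ _ (∈-pairs⁺ iv)))
∈-IPT⁺ {n} (z⇒tˡ-clause 1≤i i<n) =
  ∈-++⁺ʳ (tClauses n) (∈-++⁺ʳ (xzClauses n) (∈-++⁺ˡ (∈-ztClauses⁺ 1≤i i<n (here refl))))
∈-IPT⁺ {n} (z⇒tʳ-clause 1≤i i<n) =
  ∈-++⁺ʳ (tClauses n) (∈-++⁺ʳ (xzClauses n) (∈-++⁺ˡ (∈-ztClauses⁺ 1≤i i<n (there (here refl)))))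
∈-IPT⁺ {n} (z⇒zˡ-clause iv long) =
  ∈-++⁺ʳ (tClauses n) (∈-++⁺ʳ (xzClauses n) (∈-++⁺ʳ (ztClauses n)
    (∈-++⁺ˡ (∈-zzClauses⁺ iv long (here refl)))))
∈-IPT⁺ {n} (z⇒zʳ-clause iv long) =
  ∈-++⁺ʳ (tClauses n) (∈-++⁺ʳ (xzClauses n) (∈-++⁺ʳ (ztClauses n)
    (∈-++⁺ˡ (∈-zzClauses⁺ iv long (there (here refl))))))
-- The ascription solves the clause function of the last block of IPT n
-- before n ≤ᵇ j is abstracted.
∈-IPT⁺ {n} (extension-clause {zero} (() , _))
∈-IPT⁺ {n} (extension-clause {suc zero} {j} iv)
  with n ≤ᵇ j | (_ ∈ IPT n) ∋ ∈-IPT-suffix {n = n} (∈-map⁺ _ (∈-pairs⁺ iv))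
... | true  | m = m
... | false | m = m
∈-IPT⁺ {n} (extension-clause {suc (suc _)} {j} iv)
  with n ≤ᵇ j | (_ ∈ IPT n) ∋ ∈-IPT-suffix {n = n} (∈-map⁺ _ (∈-pairs⁺ iv))
... | true  | m = m
... | false | m = m

var : Lit → Var
var (pos v) = v
var (neg v) = v

litVal-cong : ∀ l → σ₁ (var l) ≡ σ₂ (var l) → litVal σ₁ l ≡ litVal σ₂ l
litVal-cong (pos v) eq = eq
litVal-cong (neg v) eq = cong not eq

⊨ᶜ-cong : (∀ {l} → l ∈ C → σ₁ (var l) ≡ σ₂ (var l)) → σ₁ ⊨ᶜ C → σ₂ ⊨ᶜ C
⊨ᶜ-cong agree s with find s
... | l , l∈C , h = lose l∈C (trans (sym (litVal-cong l (agree l∈C))) h)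

⊨-cong : ∀ {F} → (∀ {C l} → C ∈ F → l ∈ C → σ₁ (var l) ≡ σ₂ (var l)) → σ₁ ⊨ F → σ₂ ⊨ F
⊨-cong agree s = All.tabulate λ C∈F → ⊨ᶜ-cong (agree C∈F) (All.lookup s C∈F)

data IsXT : Var → Set where
  x-var : IsXT (x i j)
  t-var : IsXT (t ℓ)

tClause-IsXT : ∀ {l} → l ∈ tClause n ℓ → IsXT (var l)
tClause-IsXT (here refl) = t-var
tClause-IsXT {n} {ℓ} (there l∈) with find (∈-concatMap⁻ (xLits n ℓ) {range 1 ℓ} l∈)
... | i , _ , l∈′ with ∈-map⁻ _ l∈′
...   | j , _ , refl = x-var

NIPClause-IsXT : ∀ {l} → NIPClause n C → l ∈ C → IsXT (var l)
NIPClause-IsXT (t-clause _ _)     l∈                = tClause-IsXT l∈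
NIPClause-IsXT (x⇒t-clause _ _ _) (here refl)        = x-var
NIPClause-IsXT (x⇒t-clause _ _ _) (there (here refl)) = t-var

⊨NIP-cong : (∀ {v} → IsXT v → σ₁ v ≡ σ₂ v) → σ₁ ⊨ NIP n → σ₂ ⊨ NIP n
⊨NIP-cong {n = n} agree = ⊨-cong (λ C∈ l∈ → agree (NIPClause-IsXT (∈-NIP⁻ {n = n} C∈) l∈))

total≡extend-partial : ∀ τ θ {v} → IsXT v → total τ v ≡ extend (partial τ) θ v
total≡extend-partial _ _ x-var = refl
total≡extend-partial _ _ t-var = refl

⊨-⇒ᶜ⁻ : σ ⊨ᶜ (u ⇒ᶜ w) → σ u ≡ true → σ w ≡ true
⊨-⇒ᶜ⁻ (here ¬hu)       hu = contradiction (sym ¬hu) (not-¬ (sym hu))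
⊨-⇒ᶜ⁻ (there (here hw)) _  = hw

⊨-⇒ᶜ⁺ : (σ u ≡ true → σ w ≡ true) → σ ⊨ᶜ (u ⇒ᶜ w)
⊨-⇒ᶜ⁺ {σ} {u} u⇒w with σ u in e
... | true  = there (here (u⇒w refl))
... | false = here (cong not e)

Extends : Assignment → ℕ → ℕ → ℕ → Set
Extends σ n i j = (1 < i × σ (z (pred i) j) ≡ true) ⊎ (j < n × σ (z i (suc j)) ≡ true)

⊨-leftExtension⁻ : σ ⊨ᶜ leftExtension i j → 1 < i × σ (z (pred i) j) ≡ true
⊨-leftExtension⁻ {i = suc (suc _)} (here h) = s≤s (s≤s z≤n) , h

⊨-leftExtension⁺ : 1 < i → σ (z (pred i) j) ≡ true → σ ⊨ᶜ leftExtension i j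
⊨-leftExtension⁺ {i = suc zero}    (s≤s ()) _
⊨-leftExtension⁺ {i = suc (suc _)} _        h = here h

⊨-rightExtension⁻ : σ ⊨ᶜ rightExtension (n ≤ᵇ j) i j → j < n × σ (z i (suc j)) ≡ true
⊨-rightExtension⁻ {n = n} {j} ext with n ≤ᵇ j | ≤ᵇ-reflects-≤ n j | ext
... | false | ofⁿ n≰j | here h = ≰⇒> n≰j , h

⊨-rightExtension⁺ : j < n → σ (z i (suc j)) ≡ true → σ ⊨ᶜ rightExtension (n ≤ᵇ j) i j
⊨-rightExtension⁺ {j = j} {n} j<n h with n ≤ᵇ j | ≤ᵇ-reflects-≤ n j
... | true  | ofʸ n≤j = contradiction n≤j (<⇒≱ j<n)
... | false | _       = here h

⊨-extensionClause⁻ : σ ⊨ᶜ extensionClause n i j → σ (z i j) ≡ true →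
                     σ (x i j) ≡ true ⊎ Extends σ n i j
⊨-extensionClause⁻ (here ¬zij)        zij = contradiction (sym ¬zij) (not-¬ (sym zij))
⊨-extensionClause⁻ (there (here sel)) _   = inj₁ sel
⊨-extensionClause⁻ {i = i} (there (there ext)) _ with ++⁻ (leftExtension i _) ext
... | inj₁ left  = inj₂ (inj₁ (⊨-leftExtension⁻ left))
... | inj₂ right = inj₂ (inj₂ (⊨-rightExtension⁻ right))

⊨-extensionClause⁺ : (σ (z i j) ≡ true → σ (x i j) ≡ true ⊎ Extends σ n i j) →
                     σ ⊨ᶜ extensionClause n i j
⊨-extensionClause⁺ {σ} {i} {j} grow with σ (z i j) in e
... | false = here (cong not e)
... | true with grow refl
...   | inj₁ sel                 = there (here sel)
...   | inj₂ (inj₁ (1<i , left))  = there (there (++⁺ˡ (⊨-leftExtension⁺ 1<i left)))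
...   | inj₂ (inj₂ (j<n , right)) = there (there (++⁺ʳ (leftExtension i j) (⊨-rightExtension⁺ j<n right)))

Covered : ℕ → Assignment → ℕ → ℕ → Set
Covered n σ a b = ∃ λ i → ∃ λ j → 1 ≤ i × i < j × j ≤ n × σ (x i j) ≡ true × i ≤ a × b ≤ j

covered-self : Interval n i j → σ (x i j) ≡ true → Covered n σ i j
covered-self {i = i} {j} (1≤i , i<j , j≤n) sel = i , j , 1≤i , i<j , j≤n , sel , ≤-refl , ≤-refl

covered-mono : ∀ {a′ b′} → a ≤ a′ → b′ ≤ b → Covered n σ a b → Covered n σ a′ b′
covered-mono a≤a′ b′≤b (i , j , 1≤i , i<j , j≤n , sel , i≤a , b≤j) =
  i , j , 1≤i , i<j , j≤n , sel , ≤-trans i≤a a≤a′ , ≤-trans b′≤b b≤j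

covered? : ∀ n σ a b → Dec (Covered n σ a b)
covered? n σ a b = map′ fromAny toAny (Any.any? covers? (pairs n))
  where
  Covers : ℕ × ℕ → Set
  Covers p = σ (x (proj₁ p) (proj₂ p)) ≡ true × proj₁ p ≤ a × b ≤ proj₂ p
  covers? : ∀ p → Dec (Covers p)
  covers? p = (σ (x (proj₁ p) (proj₂ p)) ≟ᵇ true) ×-dec (proj₁ p ≤? a) ×-dec (b ≤? proj₂ p)
  fromAny : Any Covers (pairs n) → Covered n σ a b
  fromAny c with find c
  ... | (i , j) , ij∈ , sel , i≤a , b≤j with ∈-pairs⁻ ij∈
  ...   | 1≤i , i<j , j≤n = i , j , 1≤i , i<j , j≤n , sel , i≤a , b≤j
  toAny : Covered n σ a b → Any Covers (pairs n)
  toAny (i , j , 1≤i , i<j , j≤n , sel , i≤a , b≤j) = lose (∈-pairs⁺ (1≤i , i<j , j≤n)) (sel , i≤a , b≤j)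

withCoverage : ℕ → Assignment → Assignment
withCoverage n σ (z a b) = ⌊ covered? n σ a b ⌋
withCoverage n σ v       = σ v

withCoverage-z : withCoverage n σ (z a b) ≡ true ⇔ Covered n σ a b
withCoverage-z {n} {σ} {a} {b} =
  mk⇔ (toWitness {a? = covered? n σ a b} ∘ from T-≡) (to T-≡ ∘ fromWitness {a? = covered? n σ a b})

module IPTModel {n : ℕ} {σ : Assignment} (M : ∀ {C} → IPTClause n C → σ ⊨ᶜ C) where

  x⇒z : Interval n i j → σ (x i j) ≡ true → σ (z i j) ≡ true
  x⇒z iv = ⊨-⇒ᶜ⁻ (M (x⇒z-clause iv))

  z-shrinkˡ : Interval n i j → i ≤′ a → a < j → σ (z i j) ≡ true → σ (z a j) ≡ true
  z-shrinkˡ iv                 ≤′-refl          _   zij = zij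
  z-shrinkˡ {j = j} iv@(1≤i , _ , j≤n) (≤′-step {a} i≤′a) a+1<j zij =
    ⊨-⇒ᶜ⁻ (M (z⇒zˡ-clause (≤-trans 1≤i (≤′⇒≤ i≤′a) , a<j , j≤n) a+1<j)) (z-shrinkˡ iv i≤′a a<j zij)
    where
    a<j : a < j
    a<j = <-trans (n<1+n a) a+1<j

  z-shrinkʳ : Interval n a j → b ≤′ j → a < b → σ (z a j) ≡ true → σ (z a b) ≡ true
  z-shrinkʳ iv                   ≤′-refl            _   zaj = zaj
  z-shrinkʳ {a = a} iv@(1≤a , _ , j+1≤n) (≤′-step {j} b≤′j) a<b zaj =
    z-shrinkʳ (1≤a , a<j , ≤-trans (n≤1+n j) j+1≤n) b≤′j a<b (⊨-⇒ᶜ⁻ (M (z⇒zʳ-clause iv (s≤s a<j))) zaj)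
    where
    a<j : a < j
    a<j = <-≤-trans a<b (≤′⇒≤ b≤′j)

  z-shrink : Interval n i j → i ≤ a → a < b → b ≤ j → σ (z i j) ≡ true → σ (z a b) ≡ true
  z-shrink iv@(1≤i , _ , j≤n) i≤a a<b b≤j zij =
    z-shrinkʳ (≤-trans 1≤i i≤a , <-≤-trans a<b b≤j , j≤n) (≤⇒≤′ b≤j) a<b
      (z-shrinkˡ iv (≤⇒≤′ i≤a) (<-≤-trans a<b b≤j) zij)

  z⇒t : Interval n i j → i ≤ ℓ → ℓ ≤ j → σ (z i j) ≡ true → σ (t ℓ) ≡ true
  z⇒t iv i≤ℓ ℓ≤j zij with m≤n⇒m<n∨m≡n ℓ≤j
  z⇒t iv@(1≤i , _ , j≤n) i≤ℓ _ zij | inj₁ ℓ<j =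
    ⊨-⇒ᶜ⁻ (M (z⇒tˡ-clause (≤-trans 1≤i i≤ℓ) (<-≤-trans ℓ<j j≤n))) (z-shrink iv i≤ℓ ≤-refl ℓ<j zij)
  z⇒t iv@(1≤i , s≤s i≤j-1 , j≤n) _ _ zij | inj₂ refl =
    ⊨-⇒ᶜ⁻ (M (z⇒tʳ-clause (≤-trans 1≤i i≤j-1) j≤n)) (z-shrink iv i≤j-1 ≤-refl ≤-refl zij)

  z⇒covered : Interval n a b → σ (z a b) ≡ true → Covered n σ a b
  z⇒covered {a} {b} iv@(_ , _ , b≤n) = grow a (n ∸ b) (m∸n+n≡m b≤n) iv
    where
    -- Lexicographic induction on (a , n ∸ b), following clause (4) outwards.
    grow : ∀ a d {b} → d + b ≡ n → Interval n a b → σ (z a b) ≡ true → Covered n σ a b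
    grow a d d+b≡n iv zab with ⊨-extensionClause⁻ {σ = σ} {n = n} (M (extension-clause iv)) zab
    ... | inj₁ sel = covered-self {σ = σ} iv sel
    grow (suc a) d d+b≡n (_ , a<b , b≤n) _ | inj₂ (inj₁ (s≤s 1≤a , zab′)) =
      covered-mono {σ = σ} (n≤1+n a) ≤-refl (grow a d d+b≡n (1≤a , <-trans (n<1+n a) a<b , b≤n) zab′)
    grow a zero refl _ _ | inj₂ (inj₂ (b<n , _)) = contradiction b<n (<-irrefl refl)
    grow a (suc d) {b} d+b≡n (1≤a , a<b , _) _ | inj₂ (inj₂ (b<n , zab′)) =
      covered-mono {σ = σ} ≤-refl (n≤1+n b)
        (grow a d (trans (+-suc d b) d+b≡n) (1≤a , m<n⇒m<1+n a<b , b<n) zab′)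

  covered⇒z : Interval n a b → Covered n σ a b → σ (z a b) ≡ true
  covered⇒z (_ , a<b , _) (i , j , 1≤i , i<j , j≤n , sel , i≤a , b≤j) =
    z-shrink (1≤i , i<j , j≤n) i≤a a<b b≤j (x⇒z (1≤i , i<j , j≤n) sel)

  ⊨NIPClause : NIPClause n C → σ ⊨ᶜ C
  ⊨NIPClause (t-clause 1≤ℓ ℓ≤n)        = M (t-clause 1≤ℓ ℓ≤n)
  ⊨NIPClause (x⇒t-clause iv i≤ℓ ℓ≤j) = ⊨-⇒ᶜ⁺ (z⇒t iv i≤ℓ ℓ≤j ∘ x⇒z iv)


module CoverageModel {n : ℕ} {σ : Assignment}
  (N : ∀ {C} → NIPClause n C → σ ⊨ᶜ C)
  (Z : ∀ {a b} → Interval n a b → σ (z a b) ≡ true ⇔ Covered n σ a b) where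

  covered⇒t : Covered n σ a b → a ≤ ℓ → ℓ ≤ b → σ (t ℓ) ≡ true
  covered⇒t (i , j , 1≤i , i<j , j≤n , sel , i≤a , b≤j) a≤ℓ ℓ≤b =
    ⊨-⇒ᶜ⁻ (N (x⇒t-clause (1≤i , i<j , j≤n) (≤-trans i≤a a≤ℓ) (≤-trans ℓ≤b b≤j))) sel

  covered⇒selected∨extends : Interval n i j → Covered n σ i j → σ (x i j) ≡ true ⊎ Extends σ n i j
  covered⇒selected∨extends {i = i} {j} (1≤i , i<j , j≤n) (p , q , 1≤p , p<q , q≤n , sel , p≤i , j≤q)
    with m≤n⇒m<n∨m≡n p≤i | m≤n⇒m<n∨m≡n j≤q
  ... | inj₁ p<i  | _ = inj₂ (inj₁ (≤-<-trans 1≤p p<i , from (Z iv-1) cov-1))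
    where
    iv-1 : Interval n (pred i) j
    iv-1 = ≤-trans 1≤p (<⇒≤pred p<i) , ≤-<-trans pred[n]≤n i<j , j≤n
    cov-1 : Covered n σ (pred i) j
    cov-1 = p , q , 1≤p , p<q , q≤n , sel , <⇒≤pred p<i , j≤q
  ... | inj₂ refl | inj₁ j<q  =
    inj₂ (inj₂ (<-≤-trans j<q q≤n , from (Z (1≤i , m<n⇒m<1+n i<j , <-≤-trans j<q q≤n))
                                          (p , q , 1≤p , p<q , q≤n , sel , ≤-refl , j<q)))
  ... | inj₂ refl | inj₂ refl = inj₁ sel

  ⊨IPTClause : IPTClause n C → σ ⊨ᶜ C
  ⊨IPTClause (t-clause 1≤ℓ ℓ≤n) = N (t-clause 1≤ℓ ℓ≤n)
  ⊨IPTClause (x⇒z-clause iv) = ⊨-⇒ᶜ⁺ (from (Z iv) ∘ covered-self {σ = σ} iv)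
  ⊨IPTClause (z⇒tˡ-clause 1≤i i<n) =
    ⊨-⇒ᶜ⁺ λ zi → covered⇒t (to (Z (1≤i , ≤-refl , i<n)) zi) ≤-refl (n≤1+n _)
  ⊨IPTClause (z⇒tʳ-clause 1≤i i<n) =
    ⊨-⇒ᶜ⁺ λ zi → covered⇒t (to (Z (1≤i , ≤-refl , i<n)) zi) (n≤1+n _) ≤-refl
  ⊨IPTClause (z⇒zˡ-clause iv@(_ , _ , j≤n) i+1<j) =
    ⊨-⇒ᶜ⁺ λ zij →
      from (Z (s≤s z≤n , i+1<j , j≤n)) (covered-mono {σ = σ} (n≤1+n _) ≤-refl (to (Z iv) zij))
  ⊨IPTClause (z⇒zʳ-clause {j = suc j} iv@(1≤i , _ , j+1≤n) (s≤s i<j)) =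
    ⊨-⇒ᶜ⁺ λ zij →
      from (Z (1≤i , i<j , ≤-trans (n≤1+n j) j+1≤n)) (covered-mono {σ = σ} ≤-refl (n≤1+n j) (to (Z iv) zij))
  ⊨IPTClause (extension-clause iv) = ⊨-extensionClause⁺ (covered⇒selected∨extends iv ∘ to (Z iv))


⊨IPT⇒⊨NIP : σ ⊨ IPT n → σ ⊨ NIP n
⊨IPT⇒⊨NIP {n = n} ⊨ipt =
  All.tabulate (IPTModel.⊨NIPClause (All.lookup ⊨ipt ∘ ∈-IPT⁺ {n}) ∘ ∈-NIP⁻)

⊨IPT⇒z⇔covered : σ ⊨ IPT n → Interval n a b → σ (z a b) ≡ true ⇔ Covered n σ a b
⊨IPT⇒z⇔covered {n = n} ⊨ipt iv = mk⇔ (z⇒covered iv) (covered⇒z iv)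
  where open IPTModel (All.lookup ⊨ipt ∘ ∈-IPT⁺ {n})

⊨NIP⇒⊨IPT : σ ⊨ NIP n → (∀ {a b} → Interval n a b → σ (z a b) ≡ true ⇔ Covered n σ a b) →
            σ ⊨ IPT n
⊨NIP⇒⊨IPT {n = n} ⊨nip Z =
  All.tabulate (CoverageModel.⊨IPTClause (All.lookup ⊨nip ∘ ∈-NIP⁺ {n}) Z ∘ ∈-IPT⁻)

proposition19 : (n : ℕ) → 2 ≤ n → (τ : NIPAssignment) →
    ((total τ ⊨ NIP n) ⇔ Satisfiable (IPT n ∣ partial τ))
    × ((θ : Assignment) → θ ⊨ (IPT n ∣ partial τ) →
        (a b : ℕ) → 1 ≤ a → a < b → b ≤ n →
        (θ (z a b) ≡ true ⇔
          (∃ λ i → ∃ λ j → 1 ≤ i × i < j × j ≤ n ×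
             NIPAssignment.xval τ i j ≡ true × i ≤ a × b ≤ j)))
proposition19 n _ τ = mk⇔ satisfiable satisfied , zCoverage
  where
  satisfiable : total τ ⊨ NIP n → Satisfiable (IPT n ∣ partial τ)
  satisfiable ⊨nip = θ , ⊨-restrict⁺ (partial τ) θ (IPT n) ⊨ipt
    where
    θ : Assignment
    θ = withCoverage n (total τ)
    ⊨ipt : extend (partial τ) θ ⊨ IPT n
    ⊨ipt = ⊨NIP⇒⊨IPT {n = n} (⊨NIP-cong {n = n} (total≡extend-partial τ θ) ⊨nip)
                             λ _ → withCoverage-z {n = n} {σ = total τ}

  satisfied : Satisfiable (IPT n ∣ partial τ) → total τ ⊨ NIP n
  satisfied (θ , ⊨ipt∣τ) = ⊨NIP-cong {n = n} (sym ∘ total≡extend-partial τ θ)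
    (⊨IPT⇒⊨NIP {n = n} (⊨-restrict⁻ (partial τ) θ (IPT n) ⊨ipt∣τ))

  zCoverage : (θ : Assignment) → θ ⊨ (IPT n ∣ partial τ) → (a b : ℕ) → 1 ≤ a → a < b → b ≤ n →
              θ (z a b) ≡ true ⇔ Covered n (extend (partial τ) θ) a b
  zCoverage θ ⊨ipt∣τ _ _ 1≤a a<b b≤n = ⊨IPT⇒z⇔covered {σ = extend (partial τ) θ} {n = n}
    (⊨-restrict⁻ (partial τ) θ (IPT n) ⊨ipt∣τ) (1≤a , a<b , b≤n)
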